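{- Let $\theta\in\mathcal{L}$, let $\Delta$ be a state of the initial tableau $\mathcal{T}_0^\theta$ such that $\mathcal{M},s\models\Delta$ (every formula of $\Delta$ holds at $s$) for some multi-agent epistemic model $\mathcal{M}$ and state $s$, and let $\neg D\varphi\in\Delta$. Then there exists a state $t$ of $\mathcal{M}$ with $(s,t)\in R_D$ such that every formula of $\{\neg\varphi\}\cup\{D\psi : D\psi\in\Delta\}\cup\{\neg D\psi:\neg D\psi\in\Delta\}\cup\{K_a\chi: K_a\chi\in\Delta, a\in\Sigma\}\cup\{\neg K_a\chi:\neg K_a\chi\in\Delta, a\in\Sigma\}$ holds at $t$.
   Context: Fix a nonempty set $\mathbf{AP}$ of atomic propositions and a finite set $\Sigma$ of agents with at least two elements. The language $\mathcal{L}$: $\varphi ::= p \mid \neg\varphi \mid \varphi_1 \wedge \varphi_2 \mid K_a\varphi \mid D\varphi \mid C\varphi$ ($p\in\mathbf{AP}$, $a\in\Sigma$). A multi-agent epistemic model (MAEM) is $(\Sigma,S,\{R_a\}_{a\in\Sigma},R_D,R_C,L)$ with $S\ne\emptyset$, each $R_a$ and $R_D$ an equivalence relation on $S$, $R_D=\bigcap_a R_a$, $R_C$ the transitive closure of $\bigcup_a R_a$, $L:S\to\mathcal{P}(\mathbf{AP})$; satisfaction is standard ($K_a$, $D$, $C$ are box modalities for $R_a$, $R_D$, $R_C$). A set $\Delta\subseteq\mathcal{L}$ is fully expanded if: $\neg\neg\varphi\in\Delta\Rightarrow\varphi\in\Delta$; $\varphi\wedge\psi\in\Delta\Rightarrow\varphi,\psi\in\Delta$;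 $\neg(\varphi\wedge\psi)\in\Delta\Rightarrow\neg\varphi\in\Delta$ or $\neg\psi\in\Delta$; $K_a\varphi\in\Delta\Rightarrow D\varphi\in\Delta$; $D\varphi\in\Delta\Rightarrow\varphi\in\Delta$; $C\varphi\in\Delta\Rightarrow K_a(\varphi\wedge C\varphi)\in\Delta$ for all $a$; $\neg C\varphi\in\Delta\Rightarrow\neg K_a(\varphi\wedge C\varphi)\in\Delta$ for some $a$; and if $\varphi\in\Delta$ and $\psi$ is a subformula of $\varphi$ of the form $K_a\chi$ or $D\chi$, then $\psi\in\Delta$ or $\neg\psi\in\Delta$. For a set $\Gamma$, $\mathrm{st}(\Gamma)$ is the set of minimal fully expanded extensions of $\Gamma$. The pretableau $\mathcal{P}^\theta$: nodes are prestates and states (sets of formulas, never duplicated). Start with prestate $\{\theta\}$. Rule SR: for each prestate $\Gamma$, add every $\Delta\in\mathrm{st}(\Gamma)$ as a state. Rule KR: for each state $\Delta$ containing no pair $\chi,\neg\chi$ and each $\neg K_a\varphi\in\Delta$, add the prestate $\{\neg\varphi\}\cup\{K_a\psi\in\Delta\}\cup\{\neg K_a\psi\in\Delta\}$ with an edge from $\Delta$ marked $\neg K_a\varphi$. Rule DR: for each such state and each $\neg D\varphi\in\Delta$, add the prestate $\{\neg\varphi\}\cup\{D\psi\in\Delta\}\cup\{\neg D\psi\in\Delta\}\cup\{K_b\chi\in\Delta\}\cup\{\neg K_b\chi\in\Delta\}$ (all $b\in\Sigma$) with an edge marked $\neg D\varphi$. Repeat until nothing new arises. The initial tableau $\mathcal{T}_0^\theta$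 has as nodes the states of $\mathcal{P}^\theta$, with an edge $\Delta\xrightarrow{\chi}\Delta'$ whenever $\mathcal{P}^\theta$ has an edge from $\Delta$ marked $\chi$ to a prestate $\Gamma$ with $\Delta'\in\mathrm{st}(\Gamma)$. -}

module Defs where

open import Level using (0ℓ)
open import Data.Nat using (ℕ)
open import Data.Fin using (Fin)
open import Data.Product using (Σ; ∃; ∃-syntax; _×_; _,_)
open import Data.Sum using (_⊎_)
open import Relation.Nullary using (¬_)
open import Relation.Binary.PropositionalEquality using (_≡_)
open import Relation.Binary.Structures using (IsEquivalence)
open import Relation.Binary.Construct.Closure.Transitive using (TransClosure)

data Form (AP : Set) (n : ℕ) : Set where
  atom : AP → Form AP n
  ~_   : Form AP n → Form AP n
  _∧_  : Form AP n → Form AP n → Form AP n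
  K    : Fin n → Form AP n → Form AP n
  D    : Form AP n → Form AP n
  C    : Form AP n → Form AP n

infix 30 ~_
infixr 20 _∧_

module _ {AP : Set} {n : ℕ} where

  data Sub : Form AP n → Form AP n → Set where
    sub-refl : ∀ {φ} → Sub φ φ
    sub-~    : ∀ {ψ φ} → Sub ψ φ → Sub ψ (~ φ)
    sub-∧ˡ   : ∀ {ψ φ₁ φ₂} → Sub ψ φ₁ → Sub ψ (φ₁ ∧ φ₂)
    sub-∧ʳ   : ∀ {ψ φ₁ φ₂} → Sub ψ φ₂ → Sub ψ (φ₁ ∧ φ₂)
    sub-K    : ∀ {ψ a φ} → Sub ψ φ → Sub ψ (K a φ)
    sub-D    : ∀ {ψ φ} → Sub ψ φ → Sub ψ (D φ)
    sub-C    : ∀ {ψ φ} → Sub ψ φ → Sub ψ (C φ)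

  FSet : Set₁
  FSet = Form AP n → Set

  _⊆_ : FSet → FSet → Set
  Γ ⊆ Δ = ∀ φ → Γ φ → Δ φ

  IsKD : Form AP n → Set
  IsKD ψ = (∃[ a ] ∃[ χ ] ψ ≡ K a χ) ⊎ (∃[ χ ] ψ ≡ D χ)

  record FullyExpanded (Δ : FSet) : Set where
    field
      fe-¬¬   : ∀ φ → Δ (~ ~ φ) → Δ φ
      fe-∧    : ∀ φ ψ → Δ (φ ∧ ψ) → Δ φ × Δ ψ
      fe-¬∧   : ∀ φ ψ → Δ (~ (φ ∧ ψ)) → Δ (~ φ) ⊎ Δ (~ ψ)
      fe-K    : ∀ a φ → Δ (K a φ) → Δ (D φ)
      fe-D    : ∀ φ → Δ (D φ) → Δ φ
      fe-C    : ∀ φ → Δ (C φ) → ∀ a → Δ (K a (φ ∧ C φ))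
      fe-¬C   : ∀ φ → Δ (~ C φ) → ∃[ a ] Δ (~ K a (φ ∧ C φ))
      fe-sub  : ∀ φ ψ → Δ φ → Sub ψ φ → IsKD ψ → Δ ψ ⊎ Δ (~ ψ)

  -- Δ ∈ st(Γ): Δ is a minimal fully expanded extension of Γ
  record MinFE (Γ Δ : FSet) : Set₁ where
    field
      ext     : Γ ⊆ Δ
      fullexp : FullyExpanded Δ
      minimal : ∀ (Δ' : FSet) → FullyExpanded Δ' → Γ ⊆ Δ' → Δ' ⊆ Δ → Δ ⊆ Δ'

  Consistent : FSet → Set
  Consistent Δ = ¬ (∃[ χ ] (Δ χ × Δ (~ χ)))

  IsKa : Fin n → Form AP n → Set
  IsKa a ψ = (∃[ χ ] ψ ≡ K a χ) ⊎ (∃[ χ ] ψ ≡ ~ K a χ)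

  IsDorNegD : Form AP n → Set
  IsDorNegD ψ = (∃[ χ ] ψ ≡ D χ) ⊎ (∃[ χ ] ψ ≡ ~ D χ)

  -- prestate created by rule KR from Δ for ¬K_a φ
  KRset : FSet → Fin n → Form AP n → FSet
  KRset Δ a φ ψ = (ψ ≡ ~ φ) ⊎ (Δ ψ × IsKa a ψ)

  -- prestate created by rule DR from Δ for ¬D φ:
  -- {¬φ} ∪ {Dψ ∈ Δ} ∪ {¬Dψ ∈ Δ} ∪ {K_bχ ∈ Δ} ∪ {¬K_bχ ∈ Δ}
  DRset : FSet → Form AP n → FSet
  DRset Δ φ ψ = (ψ ≡ ~ φ) ⊎ (Δ ψ × (IsDorNegD ψ ⊎ (∃[ b ] IsKa b ψ)))

  -- Prestates and states of the pretableau P^θ.  The states of the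
  -- initial tableau T₀^θ are exactly the states of P^θ.

  mutual
    data Prestate (θ : Form AP n) : FSet → Set₁ where
      pre-init : Prestate θ (λ ψ → ψ ≡ θ)
      pre-KR   : ∀ {Δ a φ} → State θ Δ → Consistent Δ → Δ (~ K a φ)
               → Prestate θ (KRset Δ a φ)
      pre-DR   : ∀ {Δ φ} → State θ Δ → Consistent Δ → Δ (~ D φ)
               → Prestate θ (DRset Δ φ)

    data State (θ : Form AP n) : FSet → Set₁ where
      st : ∀ {Γ Δ} → Prestate θ Γ → MinFE Γ Δ → State θ Δ

  TableauState : Form AP n → FSet → Set₁
  TableauState θ Δ = State θ Δ

record MAEM (AP : Set) (n : ℕ) : Set₁ where
  field
    S        : Set
    inhabited : S
    R        : Fin n → S → S → Set
    R-equiv  : ∀ a → IsEquivalence (R a)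
    L        : S → AP → Set

  RD : S → S → Set
  RD s t = ∀ a → R a s t

  RU : S → S → Set
  RU s t = ∃[ a ] R a s t

  RC : S → S → Set
  RC = TransClosure RU

module _ {AP : Set} {n : ℕ} (M : MAEM AP n) where
  open MAEM M

  Sat : S → Form AP n → Set
  Sat s (atom p) = L s p
  Sat s (~ φ) = ¬ (Sat s φ)
  Sat s (φ ∧ ψ) = Sat s φ × Sat s ψ
  Sat s (K a φ) = ∀ t → R a s t → Sat t φ
  Sat s (D φ) = ∀ t → RD s t → Sat t φ
  Sat s (C φ) = ∀ t → RC s t → Sat t φ

module Submission where

open import Defs
open import Level using (Level; 0ℓ)
open import Data.Nat using (ℕ; _≤_)
open import Data.Product using (∃-syntax; _×_; _,_)
open import Data.Sum using (inj₁; inj₂)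
open import Relation.Nullary using (¬_)
open import Relation.Binary using (Rel)
open import Relation.Binary.PropositionalEquality using (refl)
open import Relation.Binary.Structures using (IsEquivalence)
open import Axiom.ExcludedMiddle using (ExcludedMiddle)
open import Axiom.DoubleNegationElimination using (DoubleNegationElimination; em⇒dne)

-- So any
-- R_D-successor refuting φ, which exists classically since ¬Dφ holds at s,
-- is a witness.

module _ {a ℓ p : Level} {A : Set a} {E : Rel A ℓ} (E-equiv : IsEquivalence E)
         {P : A → Set p} {s t : A} (s∼t : E s t) where
  open IsEquivalence E-equiv

  □-transfer : (∀ u → E s u → P u) → ∀ u → E t u → P u
  □-transfer □P u t∼u = □P u (trans s∼t t∼u)

  ¬□-transfer : ¬ (∀ u → E s u → P u) → ¬ (∀ u → E t u → P u)
  ¬□-transfer ¬□P □P = ¬□P λ u s∼u → □P u (trans (sym s∼t) s∼u)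

¬□⇒◇¬ : ∀ {ℓ} {A : Set ℓ} {E : Rel A ℓ} {P : A → Set ℓ} {s : A} →
        DoubleNegationElimination ℓ →
        ¬ (∀ u → E s u → P u) → ∃[ u ] (E s u × ¬ P u)
¬□⇒◇¬ dne ¬□P = dne λ ¬◇¬P → ¬□P λ u s∼u → dne λ ¬Pu → ¬◇¬P (u , s∼u , ¬Pu)

module _ {AP : Set} {n : ℕ} (M : MAEM AP n) where
  open MAEM M

  RD-isEquivalence : IsEquivalence RD
  RD-isEquivalence = record
    { refl  = λ a → IsEquivalence.refl (R-equiv a)
    ; sym   = λ s∼t a → IsEquivalence.sym (R-equiv a) (s∼t a)
    ; trans = λ s∼t t∼u a → IsEquivalence.trans (R-equiv a) (s∼t a) (t∼u a)
    }

  sat-DRset : ∀ {Δ : FSet} {φ s t} → (∀ ψ → Δ ψ → Sat M s ψ) →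
              RD s t → ¬ Sat M t φ → ∀ ψ → DRset Δ φ ψ → Sat M t ψ
  sat-DRset sat s∼t ¬φ _ (inj₁ refl) = ¬φ
  sat-DRset sat s∼t ¬φ _ (inj₂ (Δψ , inj₁ (inj₁ (_ , refl)))) =
    □-transfer RD-isEquivalence s∼t (sat _ Δψ)
  sat-DRset sat s∼t ¬φ _ (inj₂ (Δψ , inj₁ (inj₂ (_ , refl)))) =
    ¬□-transfer RD-isEquivalence s∼t (sat _ Δψ)
  sat-DRset sat s∼t ¬φ _ (inj₂ (Δψ , inj₂ (b , inj₁ (_ , refl)))) =
    □-transfer (R-equiv b) (s∼t b) (sat _ Δψ)
  sat-DRset sat s∼t ¬φ _ (inj₂ (Δψ , inj₂ (b , inj₂ (_ , refl)))) =
    ¬□-transfer (R-equiv b) (s∼t b) (sat _ Δψ)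

lemma5 : ExcludedMiddle 0ℓ →
    ∀ {AP : Set} {n : ℕ} → AP → 2 ≤ n →
    (θ : Form AP n) (Δ : FSet {AP} {n}) → TableauState θ Δ →
    (M : MAEM AP n) (s : MAEM.S M) → (∀ ψ → Δ ψ → Sat M s ψ) →
    (φ : Form AP n) → Δ (~ D φ) →
    ∃[ t ] (MAEM.RD M s t × (∀ ψ → DRset Δ φ ψ → Sat M t ψ))
lemma5 em _ _ _ Δ _ M s sat φ ¬Dφ∈Δ =
  let t , s∼t , ¬φ = ¬□⇒◇¬ {E = MAEM.RD M} (em⇒dne em) (sat _ ¬Dφ∈Δ)
  in  t , s∼t , sat-DRset M sat s∼t ¬φ
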